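{- Let $\mathcal V$ be a unital commutative quantale, $F,T\colon\mathsf{Set}\to\mathsf{Set}$ functors such that $T$ preserves weak pullbacks and $F$ preserves intersections, and $\zeta\colon T\circ F\Rightarrow F\circ T$ a natural transformation. Then $\zeta$ lifts to a natural transformation $\hat\zeta\colon\hat T_{can}\circ\hat F_{can}\Rightarrow\hat F_{can}\circ\hat T_{can}$, i.e. $\hat T_{can}(\hat F_{can}(p))\le\hat F_{can}(\hat T_{can}(p))\circ\zeta_X$ for every set $X$ and every $p\colon X\to\mathcal V$.
   Context: A unital commutative quantale $\mathcal V$ is a complete lattice $(\mathcal V,\le)$ with an associative, commutative operation $\otimes$ distributing over arbitrary joins $\bigvee$, with unit $1$. For a functor $G\colon\mathsf{Set}\to\mathsf{Set}$ and $r\in\mathcal V$ let ${\uparrow}r=\{v\in\mathcal V\mid v\ge r\}$ with inclusion $\iota_r$; for $u\in G\mathcal V$ write $u\in G({\uparrow}r)$ if $u$ is in the image of $G\iota_r$. The canonical lifting of $G$ to $\mathcal V$-valued predicates sends $p\colon X\to\mathcal V$ to $\hat G_{can}(p)\colon GX\to\mathcal V$, $\hat G_{can}(p)(u)=\bigvee\{r\mid G(p)(u)\in G({\uparrow}r)\}$. Inequalities between predicates are pointwise. -}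

module Defs where

open import Level using (0ℓ)
open import Function using (_∘_; id)
open import Data.Product using (Σ; ∃; _×_; _,_; proj₁; proj₂)
open import Relation.Binary.PropositionalEquality using (_≡_)

record Quantale : Set₁ where
  infix 4 _≤_
  infixl 7 _⊗_
  field
    Carrier   : Set
    _≤_       : Carrier → Carrier → Set
    ≤-refl    : ∀ {a} → a ≤ a
    ≤-trans   : ∀ {a b c} → a ≤ b → b ≤ c → a ≤ c
    ≤-antisym : ∀ {a b} → a ≤ b → b ≤ a → a ≡ b
    ⋁         : {I : Set} → (I → Carrier) → Carrier
    ⋁-upper   : {I : Set} (f : I → Carrier) (i : I) → f i ≤ ⋁ f
    ⋁-least   : {I : Set} (f : I → Carrier) (b : Carrier) → (∀ i → f i ≤ b) → ⋁ f ≤ b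
    _⊗_       : Carrier → Carrier → Carrier
    𝟙         : Carrier
    ⊗-assoc   : ∀ a b c → (a ⊗ b) ⊗ c ≡ a ⊗ (b ⊗ c)
    ⊗-comm    : ∀ a b → a ⊗ b ≡ b ⊗ a
    ⊗-unit    : ∀ a → 𝟙 ⊗ a ≡ a
    ⊗-distrib : ∀ a {I : Set} (f : I → Carrier) → a ⊗ ⋁ f ≡ ⋁ (λ i → a ⊗ f i)

record Functor : Set₁ where
  field
    F₀     : Set → Set
    fmap   : {A B : Set} → (A → B) → F₀ A → F₀ B
    fmap-id : {A : Set} (u : F₀ A) → fmap id u ≡ u
    fmap-∘  : {A B C : Set} (f : A → B) (g : B → C) (u : F₀ A) →
              fmap (g ∘ f) u ≡ fmap g (fmap f u)

open Functor public

record IsWeakPullback {W X Y Z : Set} (p₁ : W → X) (p₂ : W → Y)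
                      (f : X → Z) (g : Y → Z) : Set where
  field
    commutes : ∀ w → f (p₁ w) ≡ g (p₂ w)
    mediate  : ∀ x y → f x ≡ g y → Σ W λ w → (p₁ w ≡ x) × (p₂ w ≡ y)

PreservesWeakPullbacks : Functor → Set₁
PreservesWeakPullbacks G =
  {W X Y Z : Set} (p₁ : W → X) (p₂ : W → Y) (f : X → Z) (g : Y → Z) →
  IsWeakPullback p₁ p₂ f g →
  IsWeakPullback (fmap G p₁) (fmap G p₂) (fmap G f) (fmap G g)

Subset : Set → Set₁
Subset X = X → Set

incl : {X : Set} (A : Subset X) → Σ X A → X
incl A = proj₁

_∈G_ : {G : Functor} {X : Set} → F₀ G X → Subset X → Set
_∈G_ {G} {X} u A = Σ (F₀ G (Σ X A)) λ w → fmap G (incl A) w ≡ u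

-- G preserves (arbitrary) intersections: for any family (A i) of subsets
-- of X, G(⋂ A i) = ⋂ G(A i) as subsets of G X.  (The inclusion ⊆ always
-- holds; the content is the reverse inclusion, stated here.)
PreservesIntersections : Functor → Set₁
PreservesIntersections G =
  {X : Set} {I : Set} (A : I → Subset X) (u : F₀ G X) →
  (∀ i → _∈G_ {G} u (A i)) → _∈G_ {G} u (λ x → ∀ i → A i x)

record Distributive (T F : Functor) : Set₁ where
  field
    ζ          : (X : Set) → F₀ T (F₀ F X) → F₀ F (F₀ T X)
    naturality : {X Y : Set} (f : X → Y) (u : F₀ T (F₀ F X)) →
                 ζ Y (fmap T (fmap F f) u) ≡ fmap F (fmap T f) (ζ X u)

module _ (𝒱 : Quantale) where
  open Quantale 𝒱

  ↑ : Carrier → Subset Carrier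
  ↑ r v = r ≤ v

  lift-can : (G : Functor) {X : Set} → (X → Carrier) → F₀ G X → Carrier
  lift-can G p u =
    ⋁ {Σ Carrier λ r → _∈G_ {G} (fmap G p u) (↑ r)} proj₁

-- Writing ev_G : G 𝒱 → 𝒱 for the canonical lifting of the identity, every
-- canonical lifting factors as Ĝ(p) = ev_G ∘ G p.  So r ≤ T̂(F̂ p)(u) is witnessed
-- by T(ev_F)(T(F p) u) ∈ T(↑r).  Since T preserves weak pullbacks, T(F p) u then
-- lies in the T-image of ev_F⁻¹(↑r); since F preserves intersections the join
-- defining ev_F is attained, so ev_F⁻¹(↑r) is covered by F(↑r), and T(F p) u comes
-- from T(F(↑r)).  Naturality of ζ carries T(F(↑r)) into F(T(↑r)), and ev_T maps
-- T(↑r) into ↑r, so F(T̂ p)(ζ u) ∈ F(↑r).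
module Submission where

open import Defs
open import Function using (_∘_; id)
open import Data.Product using (Σ; _,_; proj₁; proj₂)
open import Relation.Binary.PropositionalEquality
  using (_≡_; refl; sym; trans; cong; subst; module ≡-Reasoning)

Covers : {B X : Set} → (B → X) → Subset X → Set
Covers {B} e A = ∀ x → A x → Σ B λ b → e b ≡ x

covering-square-isWeakPullback :
  {B X Y Z : Set} (e : B → X) (f : X → Z) (g : Y → Z) →
  (∀ x y → f x ≡ g y → Σ B λ b → e b ≡ x) →
  IsWeakPullback {Σ B λ b → Σ Y λ y → f (e b) ≡ g y}
                 (e ∘ proj₁) (proj₁ ∘ proj₂) f g
covering-square-isWeakPullback e f g cover = record
  { commutes = λ (_ , _ , fe≡g) → fe≡g
  ; mediate  = λ x y fx≡gy → let (b , eb≡x) = cover x y fx≡gy in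
                 (b , y , trans (cong f eb≡x) fx≡gy) , eb≡x , refl
  }

module _ {G : Functor} where

  ∈G-map : {X Y : Set} {A : Subset X} {B : Subset Y} (f : X → Y) →
           (∀ x → A x → B (f x)) →
           (u : F₀ G X) → _∈G_ {G} u A → _∈G_ {G} (fmap G f u) B
  ∈G-map f f[A]⊆B u (w , refl) =
      fmap G (λ (x , a) → f x , f[A]⊆B x a) w
    , trans (sym (fmap-∘ G _ proj₁ w)) (fmap-∘ G proj₁ f w)

  ∈G-mono : {X : Set} {A B : Subset X} → (∀ x → A x → B x) →
            (u : F₀ G X) → _∈G_ {G} u A → _∈G_ {G} u B
  ∈G-mono {B = B} A⊆B u u∈A =
    subst (λ v → _∈G_ {G} v B) (fmap-id G u) (∈G-map id A⊆B u u∈A)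

  fmap-covers-preimage :
    PreservesWeakPullbacks G →
    {B X Z : Set} (e : B → X) (f : X → Z) (C : Subset Z) →
    Covers e (C ∘ f) → Covers (fmap G e) (λ u → _∈G_ {G} (fmap G f u) C)
  fmap-covers-preimage wp {B = B} {Z = Z} e f C cover u (w , w↦fu) =
    let (v , v↦u , _) = IsWeakPullback.mediate (wp _ _ f proj₁ square) u w (sym w↦fu)
    in fmap G proj₁ v , trans (sym (fmap-∘ G proj₁ e v)) v↦u
    where
    square : IsWeakPullback {Σ B λ b → Σ (Σ Z C) λ y → f (e b) ≡ proj₁ y}
                            (e ∘ proj₁) (proj₁ ∘ proj₂) f proj₁
    square = covering-square-isWeakPullback e f proj₁
               λ x (_ , c) fx≡y → cover x (subst C (sym fx≡y) c)

ζ-transports-∈ : {T F : Functor} (D : Distributive T F) {X : Set} (A : Subset X)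
                 (v : F₀ T (F₀ F (Σ X A))) →
                 _∈G_ {F} (Distributive.ζ D X (fmap T (fmap F proj₁) v))
                          (λ t → _∈G_ {T} t A)
ζ-transports-∈ {T} {F} D {X} A v =
  fmap F (λ q → fmap T proj₁ q , q , refl) z , z↦ζu
  where
  open Distributive D
  open ≡-Reasoning

  z : F₀ F (F₀ T (Σ X A))
  z = ζ (Σ X A) v

  z↦ζu : fmap F proj₁ (fmap F (λ q → fmap T proj₁ q , q , refl) z)
       ≡ ζ X (fmap T (fmap F proj₁) v)
  z↦ζu = begin
    fmap F proj₁ (fmap F _ z)   ≡⟨ sym (fmap-∘ F _ proj₁ z) ⟩
    fmap F (fmap T proj₁) z     ≡⟨ sym (naturality proj₁ v) ⟩
    ζ X (fmap T (fmap F proj₁) v) ∎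

module _ (𝒱 : Quantale) where
  open Quantale 𝒱

  ev : (G : Functor) → F₀ G Carrier → Carrier
  ev G a = ⋁ {Σ Carrier λ r → _∈G_ {G} a (↑ 𝒱 r)} proj₁

  ∈↑⇒≤ev : (G : Functor) {r : Carrier} (a : F₀ G Carrier) →
           _∈G_ {G} a (↑ 𝒱 r) → r ≤ ev G a
  ∈↑⇒≤ev G {r} a a∈↑r = ⋁-upper proj₁ (r , a∈↑r)

  -- The subsets ↑s with a ∈ G(↑s) intersect to ↑(ev a), so the join is attained.
  ≤ev⇒∈↑ : {G : Functor} → PreservesIntersections G →
           (r : Carrier) → Covers (fmap G (incl (↑ 𝒱 r))) (λ a → r ≤ ev G a)
  ≤ev⇒∈↑ {G} pi r a r≤ev =
    ∈G-mono {G} (λ x below-x → ≤-trans r≤ev (⋁-least proj₁ x below-x)) a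
      (pi (λ i → ↑ 𝒱 (proj₁ i)) a proj₂)

  ζ-preserves-↑ : (F T : Functor) → PreservesWeakPullbacks T → PreservesIntersections F →
                  (D : Distributive T F) (r : Carrier) (u : F₀ T (F₀ F Carrier)) →
                  _∈G_ {T} (fmap T (ev F) u) (↑ 𝒱 r) →
                  _∈G_ {F} (fmap F (ev T) (Distributive.ζ D Carrier u)) (↑ 𝒱 r)
  ζ-preserves-↑ F T wp pi D r u Tev[u]∈↑r =
    let (v , v↦u) = covered u Tev[u]∈↑r
    in subst Fev[ζ-]∈↑r v↦u (∈G-map {F} (ev T) (∈↑⇒≤ev T) _ (ζ-transports-∈ D (↑ 𝒱 r) v))
    where
    covered : Covers (fmap T (fmap F (incl (↑ 𝒱 r))))
                     (λ u → _∈G_ {T} (fmap T (ev F) u) (↑ 𝒱 r))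
    covered = fmap-covers-preimage {T} wp (fmap F (incl (↑ 𝒱 r))) (ev F) (↑ 𝒱 r) (≤ev⇒∈↑ {F} pi r)

    Fev[ζ-]∈↑r : F₀ T (F₀ F Carrier) → Set
    Fev[ζ-]∈↑r u = _∈G_ {F} (fmap F (ev T) (Distributive.ζ D Carrier u)) (↑ 𝒱 r)

proposition28 : (𝒱 : Quantale) (F T : Functor) →
    PreservesWeakPullbacks T → PreservesIntersections F →
    (D : Distributive T F) →
    (X : Set) (p : X → Quantale.Carrier 𝒱) (u : F₀ T (F₀ F X)) →
    Quantale._≤_ 𝒱 (lift-can 𝒱 T (lift-can 𝒱 F p) u)
                   (lift-can 𝒱 F (lift-can 𝒱 T p) (Distributive.ζ D X u))
proposition28 𝒱 F T wp pi D X p u = ⋁-least proj₁ _ λ (r , Tp̂[u]∈↑r) →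
  ∈↑⇒≤ev 𝒱 F _ (subst (λ a → _∈G_ {F} a (↑ 𝒱 r)) Fev∘ζ≡Fp̂∘ζ
    (ζ-preserves-↑ 𝒱 F T wp pi D r _
      (subst (λ a → _∈G_ {T} a (↑ 𝒱 r)) (fmap-∘ T (fmap F p) (ev 𝒱 F) u) Tp̂[u]∈↑r)))
  where
  open Quantale 𝒱
  open Distributive D
  open ≡-Reasoning

  Fev∘ζ≡Fp̂∘ζ : fmap F (ev 𝒱 T) (ζ Carrier (fmap T (fmap F p) u))
             ≡ fmap F (lift-can 𝒱 T p) (ζ X u)
  Fev∘ζ≡Fp̂∘ζ = begin
    fmap F (ev 𝒱 T) (ζ Carrier (fmap T (fmap F p) u)) ≡⟨ cong (fmap F (ev 𝒱 T)) (naturality p u) ⟩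
    fmap F (ev 𝒱 T) (fmap F (fmap T p) (ζ X u))       ≡⟨ sym (fmap-∘ F (fmap T p) (ev 𝒱 T) (ζ X u)) ⟩
    fmap F (lift-can 𝒱 T p) (ζ X u)                   ∎
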